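{- Let $H$ and $r$ be as in the context, with $|V|$ odd, and let $\hat y\in\mathbb{R}^{E(I)}$ be the random vector produced by the construction in the context. Then (for every outcome of the randomness) $\hat y$ belongs to the spanning tree polytope of $H[I]$, i.e. $\hat y\ge 0$, $\sum_{e\in E(I)}\hat y_e=|I|-1$, and $\sum_{e\in E(S')}\hat y_e\le |S'|-1$ for every nonempty $S'\subseteq I$, where $E(S')$ is the set of edges with both endpoints in $S'$.
   Context: Let $H=(V,E)$ be a 4-regular, 4-edge-connected multigraph with at least four vertices and no proper min-cuts: every $S\subseteq V$ with $1<|S|<|V|-1$ has $|\partial S|\ge 6$ (so $H$ has no parallel edges), where $\partial S$ is the set of edges with exactly one endpoint in $S$. A vertex $r$ is designated external; $I=V\setminus\{r\}$; edges not incident to $r$ form $E(I)$ (internal edges); $\partial I$ denotes the four edges incident to $r$. Suppose $|V|$ is odd. Obtain $\hat H$ from $H$ by splitting $r$ into two vertices $r_1,r_2$, each incident to two of the edges of $\partial r$, and adding two parallel edges between $r_1,r_2$. Sample a random perfect matching $M$ of $\hat H$ with $\Pr[e\in M]=\tfrac14$ for every edge; set $y_e=1$ if $e\in M$ and $y_e=\tfrac13$ otherwise. Then $|M\cap\partial I|\in\{0,2\}$. If $M\cap\partial I=\emptyset$ (local decrease): pick $e$ uniformly from $\partial I$, pick $f$ uniformly among the three internal edges sharing an endpoint with $e$, and set $\hat y_f=y_f-\tfrac13$. If $|M\cap\partial I|=2$ (local increase): pick $e$ uniformly from $M\cap\partial I$, pick $f$ uniformly among the three internal edges sharing an endpoint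 with $e$, and set $\hat y_f=y_f+\tfrac13$. All other coordinates satisfy $\hat y_g=y_g$, $g\in E(I)$.
   Formalization: The distribution of the random perfect matching $M$ of $\hat H$ has rational probabilities. -}

module Defs where

open import Data.Nat as ℕ using (ℕ; zero; suc; _∸_)
open import Data.Bool using (Bool; true; false; if_then_else_; _∧_; _∨_; not; _xor_)
open import Data.Fin using (Fin) renaming (_≟_ to _≟F_)
open import Data.Fin.Subset using (Subset; ∣_∣)
open import Data.Vec using (lookup)
open import Data.Product using (_×_; _,_; proj₁; proj₂; ∃)
open import Data.Sum using (_⊎_; inj₁; inj₂)
open import Data.Unit using (⊤; tt)
open import Data.List using (List; foldr)
open import Data.List.Membership.Propositional using (_∈_)
open import Data.List.Relation.Unary.All using (All)
open import Data.Rational as Q using (ℚ; 0ℚ; 1ℚ; _/_)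
open import Data.Integer using (+_)
open import Relation.Nullary.Decidable using (⌊_⌋)
open import Relation.Binary.PropositionalEquality using (_≡_)

sumℕ : ∀ {k} → (Fin k → ℕ) → ℕ
sumℕ {zero}  f = 0
sumℕ {suc k} f = f Data.Fin.zero ℕ.+ sumℕ (λ i → f (Data.Fin.suc i))

count : ∀ {k} → (Fin k → Bool) → ℕ
count p = sumℕ (λ i → if p i then 1 else 0)

sumQ : ∀ {k} → (Fin k → Bool) → (Fin k → ℚ) → ℚ
sumQ {zero}  p z = 0ℚ
sumQ {suc k} p z =
  (if p Data.Fin.zero then z Data.Fin.zero else 0ℚ) Q.+ sumQ (λ i → p (Data.Fin.suc i)) (λ i → z (Data.Fin.suc i))

eqF : ∀ {n} → Fin n → Fin n → Bool
eqF x y = ⌊ x ≟F y ⌋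

b2n : Bool → ℕ
b2n b = if b then 1 else 0

-- Multigraphs: vertices Fin n, edges Fin m, each edge has two endpoints
-- (loops allowed a priori; a loop contributes 2 to the degree).

Graph : ℕ → ℕ → Set
Graph n m = Fin m → Fin n × Fin n

module _ {n m : ℕ} (G : Graph n m) where

  crosses : Subset n → Fin m → Bool
  crosses S e = lookup S (proj₁ (G e)) xor lookup S (proj₂ (G e))

  cut : Subset n → ℕ
  cut S = count (crosses S)

  degree : Fin n → ℕ
  degree v = sumℕ (λ e → b2n (eqF (proj₁ (G e)) v) ℕ.+ b2n (eqF (proj₂ (G e)) v))

  FourRegular : Set
  FourRegular = ∀ v → degree v ≡ 4

  FourEdgeConnected : Set
  FourEdgeConnected = ∀ (S : Subset n) → 0 ℕ.< ∣ S ∣ → ∣ S ∣ ℕ.< n → 4 ℕ.≤ cut S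

  NoProperMinCuts : Set
  NoProperMinCuts = ∀ (S : Subset n) → 1 ℕ.< ∣ S ∣ → ∣ S ∣ ℕ.< n ∸ 1 → 6 ℕ.≤ cut S

  incident : Fin n → Fin m → Bool
  incident r e = eqF (proj₁ (G e)) r ∨ eqF (proj₂ (G e)) r

  -- internal edge: e ∈ E(I), i.e. not incident to r
  internal : Fin n → Fin m → Bool
  internal r e = not (incident r e)

  shareEnd : Fin m → Fin m → Bool
  shareEnd e f = eqF (proj₁ (G e)) (proj₁ (G f)) ∨ eqF (proj₁ (G e)) (proj₂ (G f))
               ∨ eqF (proj₂ (G e)) (proj₁ (G f)) ∨ eqF (proj₂ (G e)) (proj₂ (G f))

  inside : Subset n → Fin m → Bool
  inside S e = lookup S (proj₁ (G e)) ∧ lookup S (proj₂ (G e))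

  -- A split is  side : Fin m → Bool ; an edge e
  -- incident to r is attached to r₁ if side e = true, to r₂ otherwise.
  -- Vertices of Ĥ: Fin n ⊎ ⊤, where inj₁ r plays r₁ and inj₂ tt plays r₂.
  -- Edges of Ĥ: Fin m ⊎ Fin 2 (the original edges, and two parallel r₁r₂ edges).

  HV : Set
  HV = Fin n ⊎ ⊤

  HE : Set
  HE = Fin m ⊎ Fin 2

  ValidSplit : Fin n → (Fin m → Bool) → Set
  ValidSplit r side = count (λ e → incident r e ∧ side e) ≡ 2

  eqHV : HV → HV → Bool
  eqHV (inj₁ x) (inj₁ y) = eqF x y
  eqHV (inj₁ _) (inj₂ _) = false
  eqHV (inj₂ _) (inj₁ _) = false
  eqHV (inj₂ _) (inj₂ _) = true

  liftEnd : Fin n → (Fin m → Bool) → Fin m → Fin n → HV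
  liftEnd r side e w = if eqF w r ∧ not (side e) then inj₂ tt else inj₁ w

  endsHat : Fin n → (Fin m → Bool) → HE → HV × HV
  endsHat r side (inj₁ e) = liftEnd r side e (proj₁ (G e)) , liftEnd r side e (proj₂ (G e))
  endsHat r side (inj₂ _) = inj₁ r , inj₂ tt

  coveredHat : Fin n → (Fin m → Bool) → (HE → Bool) → HV → ℕ
  coveredHat r side M x =
    sumℕ (λ e → if M (inj₁ e) then incHat (inj₁ e) else 0)
      ℕ.+ sumℕ (λ j → if M (inj₂ j) then incHat (inj₂ j) else 0)
    where
    incHat : HE → ℕ
    incHat h = b2n (eqHV x (proj₁ (endsHat r side h))) ℕ.+ b2n (eqHV x (proj₂ (endsHat r side h)))

  PerfectMatchingHat : Fin n → (Fin m → Bool) → (HE → Bool) → Set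
  PerfectMatchingHat r side M = ∀ x → coveredHat r side M x ≡ 1

  -- Distributions over perfect matchings of Ĥ: finitely many weighted
  -- perfect matchings, nonnegative weights summing to 1, with
  -- Pr[h ∈ M] = 1/4 for every edge h of Ĥ.

  Dist : Set
  Dist = List ((HE → Bool) × ℚ)

  totalWeight : (((HE → Bool) × ℚ) → Bool) → Dist → ℚ
  totalWeight p = foldr (λ mw acc → (if p mw then proj₂ mw else 0ℚ) Q.+ acc) 0ℚ

  IsQuarterMatchingDist : Fin n → (Fin m → Bool) → Dist → Set
  IsQuarterMatchingDist r side D =
    All (λ mw → PerfectMatchingHat r side (proj₁ mw) × 0ℚ Q.≤ proj₂ mw) D
    × totalWeight (λ _ → true) D ≡ 1ℚ
    × (∀ (h : HE) → totalWeight (λ mw → proj₁ mw h) D ≡ + 1 / 4)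

  InSupport : Dist → (HE → Bool) → Set
  InSupport D M = ∃ λ w → (M , w) ∈ D × 0ℚ Q.< w

  yVec : (HE → Bool) → Fin m → ℚ
  yVec M e = if M (inj₁ e) then 1ℚ else + 1 / 3

  modify : (Fin m → ℚ) → Fin m → ℚ → Fin m → ℚ
  modify y f d g = if eqF g f then y g Q.+ d else y g

  -- the spanning tree polytope of H[I] (coordinates indexed by E(I); the
  -- coordinates of non-internal edges are ignored)
  InSpanningTreePolytope : Fin n → (Fin m → ℚ) → Set
  InSpanningTreePolytope r z =
    (∀ g → internal r g ≡ true → 0ℚ Q.≤ z g)
    × sumQ (internal r) z ≡ (+ (n ∸ 2)) / 1          -- |I| - 1 = n - 2
    × (∀ (S' : Subset n) → lookup S' r ≡ false → 0 ℕ.< ∣ S' ∣ →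
         sumQ (inside S') z Q.≤ (+ (∣ S' ∣ ∸ 1)) / 1)

-- Scale by 3: 3ŷ is a natural vector, equal to 1 + 2·[g ∈ M] except at f, where it is
-- shifted by σ = −1 (decrease) or σ = +1 (increase).
-- For S ⊆ I, summing degrees over S in H (4-regular) and in M (perfect on S, as r ∉ S) gives
-- 4|S| = 2|E(S)| + |∂S| and |S| = 2|M ∩ E(S)| + |M ∩ ∂S|, hence
--   2·3ŷ(E(S)) + |∂S| + 2|M ∩ ∂S| = 6|S| + 2σ[f ∈ E(S)],
-- so the rank constraint for S reads |∂S| + 2|M ∩ ∂S| ≥ 6 + 2σ[f ∈ E(S)]. For |S| = 1 it
-- follows from 4-edge-connectivity and the oddness of |M ∩ ∂S|; for 1 < |S| < |I| from
-- |∂S| ≥ 6 and, if f ∈ E(S), the matched edge e at r, which then lies in ∂S; for S = I from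
-- |∂I| = 4, f ∈ E(I) and, for the increase, from |M ∩ ∂I| being even (as |I| is) and
-- positive. For S = I every bound is tight, which gives the total |I| − 1.
module Submission where

open import Defs
open import Data.Nat using (ℕ; zero; suc; _+_; _*_; _∸_; _≤_; _<_; _%_; z≤n; s≤s)
open import Data.Nat.Properties hiding (_≟_)
open import Data.Nat.DivMod using ([m+kn]%n≡m%n)
open import Data.Nat.Tactic.RingSolver using (solve-∀)
open import Data.Bool using (Bool; true; false; if_then_else_; _∧_; _∨_; not; _xor_; T)
open import Data.Bool.Properties using (¬-not; xor-annihilates-not)
open import Data.Fin using (Fin; zero; suc; _≟_)
open import Data.Fin.Subset using (Subset; ∣_∣; ⁅_⁆; ∁; _∈_; _⊆_)
open import Data.Fin.Subset.Properties
  using (∣∁p∣≡n∸∣p∣; ∣⁅x⁆∣≡1; x∈⁅x⁆; p⊆q⇒∣p∣≤∣q∣; p⊂q⇒∣p∣<∣q∣; x∉p⇒x∈∁p; x∈∁p⇒x∉p; x≢y⇒x∉⁅y⁆)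
open import Data.Vec using (lookup; _∷_; [])
open import Data.Vec.Properties using ([]=⇒lookup; lookup⇒[]=)
open import Data.Sum using (_⊎_; inj₁; inj₂)
open import Data.Product using (_×_; _,_; proj₁; proj₂)
open import Data.Unit using (tt)
open import Data.Integer as ℤ using (ℤ; +_)
open import Data.Rational as Q using (ℚ; 0ℚ; -_; _/_)
import Data.Rational.Properties as Qₚ
open import Data.Rational.Unnormalised as Qᵘ using (mkℚᵘ; *≡*; *≤*)
import Data.Rational.Unnormalised.Properties as Qᵘₚ
import Data.Integer.Properties as ℤₚ
import Data.Integer.Tactic.RingSolver as ℤ-Solver
open import Data.List.Relation.Unary.All as All using ()
open import Function using (_∘_; mk⇔)
open import Relation.Nullary using (contradiction; yes; no)
open import Relation.Nullary.Decidable using (isYes≗does; dec-true; dec-false; does-⇔; ⌊⌋-map′; toWitness)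
open import Relation.Binary.PropositionalEquality
open import Algebra.Properties.Semiring.Sum +-*-semiring using (sum; ∑-distrib-+; *-distribˡ-sum)

≡⇒eqF : ∀ {n} {x y : Fin n} → x ≡ y → eqF x y ≡ true
≡⇒eqF {x = x} {y} x≡y = trans (isYes≗does (x ≟ y)) (dec-true (x ≟ y) x≡y)

≢⇒eqF : ∀ {n} {x y : Fin n} → x ≢ y → eqF x y ≡ false
≢⇒eqF {x = x} {y} x≢y = trans (isYes≗does (x ≟ y)) (dec-false (x ≟ y) x≢y)

eqF⇒≡ : ∀ {n} {x y : Fin n} → eqF x y ≡ true → x ≡ y
eqF⇒≡ {x = x} {y} e = toWitness {a? = x ≟ y} (subst T (sym e) tt)

eqF⇒≢ : ∀ {n} {x y : Fin n} → eqF x y ≡ false → x ≢ y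
eqF⇒≢ x≠y x≡y = contradiction (trans (sym (≡⇒eqF x≡y)) x≠y) (λ ())

eqF-sym : ∀ {n} (x y : Fin n) → eqF x y ≡ eqF y x
eqF-sym x y = trans (isYes≗does (x ≟ y))
  (trans (does-⇔ (mk⇔ sym sym) (x ≟ y) (y ≟ x)) (sym (isYes≗does (y ≟ x))))

eqF-suc : ∀ {n} (x y : Fin n) → eqF (suc x) (suc y) ≡ eqF x y
eqF-suc x y = ⌊⌋-map′ (cong suc) _ (x ≟ y)

∨-true : ∀ {a b} → a ∨ b ≡ true → a ≡ true ⊎ b ≡ true
∨-true {true}  _ = inj₁ refl
∨-true {false} b = inj₂ b

∧-false : ∀ {a b} → a ∧ b ≡ false → a ≡ false ⊎ b ≡ false
∧-false {true}  b = inj₂ b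
∧-false {false} _ = inj₁ refl

∧-true : ∀ {a b} → a ∧ b ≡ true → a ≡ true × b ≡ true
∧-true {true} {true} _ = refl , refl

xor-true : ∀ {a b} → a ≡ true ⊎ b ≡ true → a ≡ false ⊎ b ≡ false → a xor b ≡ true
xor-true {true}  {false} _ _ = refl
xor-true {false} {true}  _ _ = refl
xor-true {true}  {true}  _ (inj₁ ())
xor-true {true}  {true}  _ (inj₂ ())
xor-true {false} {false} (inj₁ ()) _
xor-true {false} {false} (inj₂ ()) _

b2n-split : ∀ x y → b2n x + b2n y ≡ 2 * b2n (x ∧ y) + b2n (x xor y)
b2n-split true  true  = refl
b2n-split true  false = refl
b2n-split false true  = refl
b2n-split false false = refl

not-∨ : ∀ a b → not a ∧ not b ≡ not (a ∨ b)
not-∨ true  b = refl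
not-∨ false b = refl

nor-true : ∀ {a b} → not (a ∨ b) ≡ true → a ≡ false × b ≡ false
nor-true {false} {false} _ = refl , refl

b2n-xor≤ : ∀ a b → b2n (a xor b) ≤ b2n a + b2n b
b2n-xor≤ true  true  = z≤n
b2n-xor≤ true  false = ≤-refl
b2n-xor≤ false b     = ≤-refl

b2n-∧-xor≤ : ∀ x a b → b2n (x ∧ (a xor b)) ≤ b2n ((a ∨ b) ∧ x)
b2n-∧-xor≤ false a     b     = z≤n
b2n-∧-xor≤ true  true  true  = z≤n
b2n-∧-xor≤ true  true  false = ≤-refl
b2n-∧-xor≤ true  false true  = ≤-refl
b2n-∧-xor≤ true  false false = z≤n

sumℕ≡sum : ∀ {k} (f : Fin k → ℕ) → sumℕ f ≡ sum f
sumℕ≡sum {zero}  f = refl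
sumℕ≡sum {suc k} f = cong (_+_ (f zero)) (sumℕ≡sum (f ∘ suc))

sumℕ-cong : ∀ {k} {f g : Fin k → ℕ} → (∀ i → f i ≡ g i) → sumℕ f ≡ sumℕ g
sumℕ-cong {zero}  f≗g = refl
sumℕ-cong {suc k} f≗g = cong₂ _+_ (f≗g zero) (sumℕ-cong (f≗g ∘ suc))

sumℕ-+ : ∀ {k} (f g : Fin k → ℕ) → sumℕ (λ i → f i + g i) ≡ sumℕ f + sumℕ g
sumℕ-+ f g = trans (sumℕ≡sum (λ i → f i + g i))
  (trans (∑-distrib-+ f g) (sym (cong₂ _+_ (sumℕ≡sum f) (sumℕ≡sum g))))

sumℕ-*ˡ : ∀ {k} (c : ℕ) (f : Fin k → ℕ) → sumℕ (λ i → c * f i) ≡ c * sumℕ f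
sumℕ-*ˡ c f = trans (sumℕ≡sum (λ i → c * f i))
  (trans (sym (*-distribˡ-sum c f)) (cong (c *_) (sym (sumℕ≡sum f))))

sumℕ-zero : ∀ {k} → sumℕ {k} (λ _ → 0) ≡ 0
sumℕ-zero {zero}  = refl
sumℕ-zero {suc k} = sumℕ-zero {k}

sumℕ-comm : ∀ {k l} (h : Fin k → Fin l → ℕ) →
  sumℕ (λ i → sumℕ (λ j → h i j)) ≡ sumℕ (λ j → sumℕ (λ i → h i j))
sumℕ-comm {zero} {l} h = sym (sumℕ-zero {l})
sumℕ-comm {suc k} h = trans (cong (_+_ (sumℕ (h zero))) (sumℕ-comm (h ∘ suc)))
  (sym (sumℕ-+ (h zero) (λ j → sumℕ (λ i → h (suc i) j))))

sumℕ-mono : ∀ {k} {f g : Fin k → ℕ} → (∀ i → f i ≤ g i) → sumℕ f ≤ sumℕ g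
sumℕ-mono {zero}  f≤g = z≤n
sumℕ-mono {suc k} f≤g = +-mono-≤ (f≤g zero) (sumℕ-mono (f≤g ∘ suc))

term≤sumℕ : ∀ {k} (f : Fin k → ℕ) (i : Fin k) → f i ≤ sumℕ f
term≤sumℕ f zero    = m≤m+n _ _
term≤sumℕ f (suc i) = ≤-trans (term≤sumℕ (f ∘ suc) i) (m≤n+m _ (f zero))

sumℕ-indicator : ∀ {k} (x : Fin k) (h : Fin k → ℕ) → sumℕ (λ v → b2n (eqF x v) * h v) ≡ h x
sumℕ-indicator {suc k} zero h =
  trans (cong (_+_ (h zero + 0)) (sumℕ-zero {k})) (trans (+-identityʳ _) (+-identityʳ _))
sumℕ-indicator {suc k} (suc x) h = trans (sumℕ-cong {k} picked) (sumℕ-indicator x (h ∘ suc))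
  where
  picked : ∀ v → b2n (eqF (suc x) (suc v)) * h (suc v) ≡ b2n (eqF x v) * h (suc v)
  picked v = cong (λ b → b2n b * h (suc v)) (eqF-suc x v)

∣S∣≡sumℕ : ∀ {k} (S : Subset k) → ∣ S ∣ ≡ sumℕ (λ v → b2n (lookup S v))
∣S∣≡sumℕ []          = refl
∣S∣≡sumℕ (true ∷ S)  = cong suc (∣S∣≡sumℕ S)
∣S∣≡sumℕ (false ∷ S) = ∣S∣≡sumℕ S

sumℕ-over-subset : ∀ {k} (S : Subset k) (h : Fin k → ℕ) (d : ℕ) →
  (∀ v → lookup S v ≡ true → h v ≡ d) → sumℕ (λ v → b2n (lookup S v) * h v) ≡ d * ∣ S ∣
sumℕ-over-subset S h d h≡d =
  trans (sumℕ-cong constant) (trans (sumℕ-*ˡ d (λ v → b2n (lookup S v))) (cong (d *_) (sym (∣S∣≡sumℕ S))))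
  where
  constant : ∀ v → b2n (lookup S v) * h v ≡ d * b2n (lookup S v)
  constant v with lookup S v in v∈S
  ... | true  = trans (+-identityʳ (h v)) (trans (h≡d v v∈S) (sym (*-identityʳ d)))
  ... | false = sym (*-zeroʳ d)

sumOn : ∀ {k} → (Fin k → Bool) → (Fin k → ℕ) → ℕ
sumOn p t = sumℕ (λ i → if p i then t i else 0)

sumOn-cong : ∀ {k} (p : Fin k → Bool) {t u : Fin k → ℕ} → (∀ i → t i ≡ u i) → sumOn p t ≡ sumOn p u
sumOn-cong p t≗u = sumℕ-cong (λ i → cong (λ x → if p i then x else 0) (t≗u i))

sumOn-bump : ∀ {k} (p : Fin k → Bool) (t : Fin k → ℕ) (f : Fin k) →
  sumOn p (λ g → if eqF g f then 1 + t g else t g) ≡ sumOn p t + b2n (p f)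
sumOn-bump p t f =
  trans (sumℕ-cong bumped)
    (trans (sumℕ-+ (λ g → if p g then t g else 0) (λ g → b2n (eqF f g) * b2n (p g)))
      (cong (_+_ (sumOn p t)) (sumℕ-indicator f (λ g → b2n (p g)))))
  where
  bumped : ∀ g → (if p g then (if eqF g f then 1 + t g else t g) else 0)
                 ≡ (if p g then t g else 0) + b2n (eqF f g) * b2n (p g)
  bumped g rewrite eqF-sym f g with p g | eqF g f
  ... | true  | true  = +-comm 1 (t g)
  ... | true  | false = sym (+-identityʳ (t g))
  ... | false | true  = refl
  ... | false | false = refl

-- Degrees in a multigraph

module _ {n m : ℕ} (G : Graph n m) where

  ends : Fin m → Fin n → ℕ
  ends e v = b2n (eqF (proj₁ (G e)) v) + b2n (eqF (proj₂ (G e)) v)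

  degreeIn : (Fin m → Bool) → Fin n → ℕ
  degreeIn N v = sumℕ (λ e → if N e then ends e v else 0)

  sumℕ-ends : ∀ e (h : Fin n → ℕ) → sumℕ (λ v → ends e v * h v) ≡ h (proj₁ (G e)) + h (proj₂ (G e))
  sumℕ-ends e h = trans (sumℕ-cong (λ v → *-distribʳ-+ (h v) (b2n (eqF (proj₁ (G e)) v)) _))
    (trans (sumℕ-+ (λ v → b2n (eqF (proj₁ (G e)) v) * h v) (λ v → b2n (eqF (proj₂ (G e)) v) * h v))
      (cong₂ _+_ (sumℕ-indicator (proj₁ (G e)) h) (sumℕ-indicator (proj₂ (G e)) h)))

  edge-contribution : (S : Subset n) (N : Fin m → Bool) (e : Fin m) →
    sumℕ (λ v → b2n (lookup S v) * (if N e then ends e v else 0))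
      ≡ 2 * b2n (N e ∧ inside G S e) + b2n (N e ∧ crosses G S e)
  edge-contribution S N e with N e
  ... | true  = trans (sumℕ-cong (λ v → *-comm (b2n (lookup S v)) (ends e v)))
                  (trans (sumℕ-ends e (λ v → b2n (lookup S v)))
                    (b2n-split (lookup S (proj₁ (G e))) (lookup S (proj₂ (G e)))))
  ... | false = trans (sumℕ-cong (λ v → *-zeroʳ (b2n (lookup S v)))) (sumℕ-zero {n})

  sum-degreeIn : (N : Fin m → Bool) (S : Subset n) →
    sumℕ (λ v → b2n (lookup S v) * degreeIn N v)
      ≡ 2 * count (λ e → N e ∧ inside G S e) + count (λ e → N e ∧ crosses G S e)
  sum-degreeIn N S = begin
    sumℕ (λ v → s v * degreeIn N v)
      ≡⟨ sumℕ-cong (λ v → sym (sumℕ-*ˡ (s v) (λ e → term e v))) ⟩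
    sumℕ (λ v → sumℕ (λ e → s v * term e v))
      ≡⟨ sumℕ-comm (λ v e → s v * term e v) ⟩
    sumℕ (λ e → sumℕ (λ v → s v * term e v))
      ≡⟨ sumℕ-cong (edge-contribution S N) ⟩
    sumℕ (λ e → 2 * b2n (N e ∧ inside G S e) + b2n (N e ∧ crosses G S e))
      ≡⟨ sumℕ-+ (λ e → 2 * b2n (N e ∧ inside G S e)) (λ e → b2n (N e ∧ crosses G S e)) ⟩
    sumℕ (λ e → 2 * b2n (N e ∧ inside G S e)) + count (λ e → N e ∧ crosses G S e)
      ≡⟨ cong (_+ count (λ e → N e ∧ crosses G S e)) (sumℕ-*ˡ 2 (λ e → b2n (N e ∧ inside G S e))) ⟩
    2 * count (λ e → N e ∧ inside G S e) + count (λ e → N e ∧ crosses G S e) ∎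
    where
    open ≡-Reasoning
    s : Fin n → ℕ
    s v = b2n (lookup S v)
    term : Fin m → Fin n → ℕ
    term e v = if N e then ends e v else 0

  regular-handshake : ∀ {d} → (∀ v → degree G v ≡ d) → (S : Subset n) →
    d * ∣ S ∣ ≡ 2 * count (inside G S) + cut G S
  regular-handshake {d} regular S =
    trans (sym (sumℕ-over-subset S (degreeIn (λ _ → true)) d (λ v _ → regular v)))
      (sum-degreeIn (λ _ → true) S)

  perfect-on-subset : (N : Fin m → Bool) (S : Subset n) →
    (∀ v → lookup S v ≡ true → degreeIn N v ≡ 1) →
    ∣ S ∣ ≡ 2 * count (λ e → N e ∧ inside G S e) + count (λ e → N e ∧ crosses G S e)
  perfect-on-subset N S covered =
    trans (sym (*-identityˡ ∣ S ∣))
      (trans (sym (sumℕ-over-subset S (degreeIn N) 1 covered)) (sum-degreeIn N S))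

module _ {n m : ℕ} (G : Graph n m) (r : Fin n) (side : Fin m → Bool) where

  liftEnd-away : ∀ {v} → v ≢ r → ∀ e w → eqHV G (inj₁ v) (liftEnd G r side e w) ≡ eqF w v
  liftEnd-away {v} v≢r e w with eqF w r in w≡r
  ... | false = eqF-sym v w
  ... | true with side e
  ...   | true  = trans (≢⇒eqF (λ v≡w → v≢r (trans v≡w (eqF⇒≡ w≡r))))
                        (sym (≢⇒eqF (λ w≡v → v≢r (trans (sym w≡v) (eqF⇒≡ w≡r)))))
  ...   | false = sym (≢⇒eqF (λ w≡v → v≢r (trans (sym w≡v) (eqF⇒≡ w≡r))))

  coveredHat-away : (M : HE G → Bool) → ∀ {v} → v ≢ r →
    coveredHat G r side M (inj₁ v) ≡ degreeIn G (M ∘ inj₁) v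
  coveredHat-away M {v} v≢r =
    trans (cong₂ _+_ (sumℕ-cong original) (trans (sumℕ-cong new) (sumℕ-zero {2}))) (+-identityʳ _)
    where
    lifted : ∀ e → b2n (eqHV G (inj₁ v) (liftEnd G r side e (proj₁ (G e))))
                     + b2n (eqHV G (inj₁ v) (liftEnd G r side e (proj₂ (G e)))) ≡ ends G e v
    lifted e = cong₂ _+_ (cong b2n (liftEnd-away v≢r e (proj₁ (G e))))
                         (cong b2n (liftEnd-away v≢r e (proj₂ (G e))))
    original : ∀ e → (if M (inj₁ e) then b2n (eqHV G (inj₁ v) (liftEnd G r side e (proj₁ (G e))))
                                          + b2n (eqHV G (inj₁ v) (liftEnd G r side e (proj₂ (G e))))
                                     else 0)
                     ≡ (if M (inj₁ e) then ends G e v else 0)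
    original e = cong (λ x → if M (inj₁ e) then x else 0) (lifted e)
    new : ∀ j → (if M (inj₂ j) then b2n (eqF v r) + 0 else 0) ≡ 0
    new j rewrite ≢⇒eqF v≢r with M (inj₂ j)
    ... | true  = refl
    ... | false = refl

-- mkℚᵘ takes the denominator minus one, so this is t / 3.
thirds : ℕ → ℚ
thirds t = Q.fromℚᵘ (mkℚᵘ (+ t) 2)

toℚᵘ-thirds : ∀ t → Q.toℚᵘ (thirds t) Qᵘ.≃ mkℚᵘ (+ t) 2
toℚᵘ-thirds t = Qₚ.toℚᵘ-fromℚᵘ (mkℚᵘ (+ t) 2)

thirds-+ : ∀ a b → thirds a Q.+ thirds b ≡ thirds (a + b)
thirds-+ a b = Qₚ.toℚᵘ-injective (begin
  Q.toℚᵘ (thirds a Q.+ thirds b)             ≈⟨ Qₚ.toℚᵘ-homo-+ (thirds a) (thirds b) ⟩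
  Q.toℚᵘ (thirds a) Qᵘ.+ Q.toℚᵘ (thirds b)   ≈⟨ Qᵘₚ.+-cong (toℚᵘ-thirds a) (toℚᵘ-thirds b) ⟩
  mkℚᵘ (+ a) 2 Qᵘ.+ mkℚᵘ (+ b) 2             ≈⟨ *≡* (common-denominator (+ a) (+ b)) ⟩
  mkℚᵘ (+ (a + b)) 2                         ≈⟨ toℚᵘ-thirds (a + b) ⟨
  Q.toℚᵘ (thirds (a + b))                    ∎)
  where
  open Qᵘₚ.≃-Reasoning
  common-denominator : ∀ (x y : ℤ) → (x ℤ.* + 3 ℤ.+ y ℤ.* + 3) ℤ.* + 3 ≡ (x ℤ.+ y) ℤ.* + 9
  common-denominator = ℤ-Solver.solve-∀

thirds-mono : ∀ {a b} → a ≤ b → thirds a Q.≤ thirds b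
thirds-mono {a} {b} a≤b = Qₚ.toℚᵘ-cancel-≤
  (Qᵘₚ.≤-respˡ-≃ (Qᵘₚ.≃-sym (toℚᵘ-thirds a)) (Qᵘₚ.≤-respʳ-≃ (Qᵘₚ.≃-sym (toℚᵘ-thirds b))
    (*≤* (ℤₚ.*-monoʳ-≤-nonNeg (+ 3) (ℤ.+≤+ a≤b)))))

thirds-3* : ∀ x → thirds (3 * x) ≡ + x / 1
thirds-3* x = Qₚ.fromℚᵘ-cong {mkℚᵘ (+ (3 * x)) 2} {mkℚᵘ (+ x) 0} (*≡* (trans (cong (ℤ._* + 1) (ℤₚ.pos-* 3 x)) (three-x (+ x))))
  where
  three-x : ∀ (a : ℤ) → (+ 3 ℤ.* a) ℤ.* + 1 ≡ a ℤ.* + 3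
  three-x = ℤ-Solver.solve-∀

sumQ-thirds : ∀ {k} (p : Fin k → Bool) (t : Fin k → ℕ) {z : Fin k → ℚ} →
  (∀ i → z i ≡ thirds (t i)) → sumQ p z ≡ thirds (sumOn p t)
sumQ-thirds {zero}  p t z≡ = refl
sumQ-thirds {suc k} p t {z} z≡ with p zero
... | true  = trans (cong₂ Q._+_ (z≡ zero) (sumQ-thirds (p ∘ suc) (t ∘ suc) (z≡ ∘ suc)))
                (thirds-+ (t zero) (sumOn (p ∘ suc) (t ∘ suc)))
... | false = trans (Qₚ.+-identityˡ (sumQ (p ∘ suc) (z ∘ suc))) (sumQ-thirds (p ∘ suc) (t ∘ suc) (z≡ ∘ suc))

in-polytope : ∀ {n m} (G : Graph n m) (r : Fin n) (t : Fin m → ℕ) {z : Fin m → ℚ} →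
  (∀ g → z g ≡ thirds (t g)) →
  sumOn (internal G r) t ≡ 3 * (n ∸ 2) →
  (∀ (S : Subset n) → lookup S r ≡ false → 0 < ∣ S ∣ → sumOn (inside G S) t ≤ 3 * (∣ S ∣ ∸ 1)) →
  InSpanningTreePolytope G r z
in-polytope {n} G r t {z} z≡ total bound = nonneg , sum-total , sum-bound
  where
  nonneg : ∀ g → internal G r g ≡ true → 0ℚ Q.≤ z g
  nonneg g _ = subst (0ℚ Q.≤_) (sym (z≡ g)) (thirds-mono {0} {t g} z≤n)
  sum-total : sumQ (internal G r) z ≡ + (n ∸ 2) / 1
  sum-total = trans (sumQ-thirds (internal G r) t z≡) (trans (cong thirds total) (thirds-3* (n ∸ 2)))
  sum-bound : ∀ (S : Subset n) → lookup S r ≡ false → 0 < ∣ S ∣ →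
    sumQ (inside G S) z Q.≤ + (∣ S ∣ ∸ 1) / 1
  sum-bound S r∉S S≢∅ = begin
    sumQ (inside G S) z                ≡⟨ sumQ-thirds (inside G S) t z≡ ⟩
    thirds (sumOn (inside G S) t)      ≤⟨ thirds-mono (bound S r∉S S≢∅) ⟩
    thirds (3 * (∣ S ∣ ∸ 1))           ≡⟨ thirds-3* (∣ S ∣ ∸ 1) ⟩
    + (∣ S ∣ ∸ 1) / 1                  ∎
    where open Qₚ.≤-Reasoning

-- y₃ = 3y, and ŷ₃⁻ f, ŷ₃⁺ f are 3ŷ after the local decrease, increase at f.
module Scaled {n m : ℕ} (G : Graph n m) (M : HE G → Bool) where

  y₃ : Fin m → ℕ
  y₃ g = 1 + 2 * b2n (M (inj₁ g))

  ŷ₃⁻ : Fin m → Fin m → ℕ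
  ŷ₃⁻ f g = if eqF g f then 2 * b2n (M (inj₁ g)) else y₃ g

  ŷ₃⁺ : Fin m → Fin m → ℕ
  ŷ₃⁺ f g = if eqF g f then 1 + y₃ g else y₃ g

  modify-decrease : ∀ f g → modify G (yVec G M) f (- (+ 1 / 3)) g ≡ thirds (ŷ₃⁻ f g)
  modify-decrease f g with eqF g f | M (inj₁ g)
  ... | true  | true  = refl
  ... | true  | false = refl
  ... | false | true  = refl
  ... | false | false = refl

  modify-increase : ∀ f g → modify G (yVec G M) f (+ 1 / 3) g ≡ thirds (ŷ₃⁺ f g)
  modify-increase f g with eqF g f | M (inj₁ g)
  ... | true  | true  = refl
  ... | true  | false = refl
  ... | false | true  = refl
  ... | false | false = refl

  sumOn-y₃ : ∀ p → sumOn p y₃ ≡ count p + 2 * count (λ g → M (inj₁ g) ∧ p g)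
  sumOn-y₃ p = trans (sumℕ-cong split)
    (trans (sumℕ-+ (λ g → b2n (p g)) (λ g → 2 * b2n (M (inj₁ g) ∧ p g)))
      (cong (_+_ (count p)) (sumℕ-*ˡ 2 (λ g → b2n (M (inj₁ g) ∧ p g)))))
    where
    split : ∀ g → (if p g then y₃ g else 0) ≡ b2n (p g) + 2 * b2n (M (inj₁ g) ∧ p g)
    split g with p g | M (inj₁ g)
    ... | true  | true  = refl
    ... | true  | false = refl
    ... | false | true  = refl
    ... | false | false = refl

  sumOn-ŷ₃⁻ : ∀ f p → sumOn p (ŷ₃⁻ f) + b2n (p f) ≡ sumOn p y₃
  sumOn-ŷ₃⁻ f p = trans (sym (sumOn-bump p (ŷ₃⁻ f) f)) (sumOn-cong p restore)
    where
    restore : ∀ g → (if eqF g f then 1 + ŷ₃⁻ f g else ŷ₃⁻ f g) ≡ y₃ g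
    restore g with eqF g f
    ... | true  = refl
    ... | false = refl

  sumOn-ŷ₃⁺ : ∀ f p → sumOn p (ŷ₃⁺ f) ≡ sumOn p y₃ + b2n (p f)
  sumOn-ŷ₃⁺ f p = sumOn-bump p y₃ f

scaled-identity : ∀ {k E c μ δ} → 4 * k ≡ 2 * E + c → k ≡ 2 * μ + δ →
  2 * (E + 2 * μ) + (c + 2 * δ) ≡ 6 * k
scaled-identity {k} {E} {c} {μ} {δ} handshake matching = begin
  2 * (E + 2 * μ) + (c + 2 * δ)  ≡⟨ regroup E μ c δ ⟩
  (2 * E + c) + 2 * (2 * μ + δ)  ≡⟨ cong₂ (λ a b → a + 2 * b) handshake matching ⟨
  4 * k + 2 * k                  ≡⟨ six k ⟩
  6 * k                          ∎
  where
  open ≡-Reasoning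
  regroup : ∀ E μ c δ → 2 * (E + 2 * μ) + (c + 2 * δ) ≡ (2 * E + c) + 2 * (2 * μ + δ)
  regroup = solve-∀
  six : ∀ k → 4 * k + 2 * k ≡ 6 * k
  six = solve-∀

scaled-bound : ∀ {T X Y k} → 2 * T + X ≡ 6 * k + Y → 6 + Y ≤ X → T ≤ 3 * (k ∸ 1)
scaled-bound {T} {X} {Y} {k} eq 6+Y≤X = begin
  T               ≡⟨ m+n∸n≡m T 3 ⟨
  T + 3 ∸ 3       ≤⟨ ∸-monoˡ-≤ 3 (*-cancelˡ-≤ {T + 3} {3 * k} 2 doubled) ⟩
  3 * k ∸ 3       ≡⟨ *-distribˡ-∸ 3 k 1 ⟨
  3 * (k ∸ 1)     ∎
  where
  open ≤-Reasoning
  doubled : 2 * (T + 3) ≤ 2 * (3 * k)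
  doubled = +-cancelʳ-≤ Y (2 * (T + 3)) (2 * (3 * k)) (begin
    2 * (T + 3) + Y  ≡⟨ cong (_+ Y) (*-distribˡ-+ 2 T 3) ⟩
    2 * T + 6 + Y    ≡⟨ +-assoc (2 * T) 6 Y ⟩
    2 * T + (6 + Y)  ≤⟨ +-monoʳ-≤ (2 * T) 6+Y≤X ⟩
    2 * T + X        ≡⟨ eq ⟩
    6 * k + Y        ≡⟨ cong (_+ Y) (*-assoc 2 3 k) ⟩
    2 * (3 * k) + Y  ∎)

scaled-exact : ∀ {T X Y k} → 2 * T + X ≡ 6 * k + Y → X ≡ 6 + Y → T ≡ 3 * (k ∸ 1)
scaled-exact {T} {X} {Y} {k} eq X≡6+Y = begin
  T               ≡⟨ m+n∸n≡m T 3 ⟨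
  T + 3 ∸ 3       ≡⟨ cong (_∸ 3) (*-cancelˡ-≡ (T + 3) (3 * k) 2 doubled) ⟩
  3 * k ∸ 3       ≡⟨ *-distribˡ-∸ 3 k 1 ⟨
  3 * (k ∸ 1)     ∎
  where
  open ≡-Reasoning
  doubled : 2 * (T + 3) ≡ 2 * (3 * k)
  doubled = +-cancelʳ-≡ Y (2 * (T + 3)) (2 * (3 * k)) (begin
    2 * (T + 3) + Y  ≡⟨ cong (_+ Y) (*-distribˡ-+ 2 T 3) ⟩
    2 * T + 6 + Y    ≡⟨ +-assoc (2 * T) 6 Y ⟩
    2 * T + (6 + Y)  ≡⟨ cong (_+_ (2 * T)) X≡6+Y ⟨
    2 * T + X        ≡⟨ eq ⟩
    6 * k + Y        ≡⟨ cong (_+ Y) (*-assoc 2 3 k) ⟩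
    2 * (3 * k) + Y  ∎)

positive-≤-pred⇒< : ∀ {k n} → 0 < k → k ≤ n ∸ 1 → k < n
positive-≤-pred⇒< {n = suc n} _   k≤n = s≤s k≤n
positive-≤-pred⇒< {n = zero}  0<k k≤0 = contradiction (≤-trans 0<k k≤0) (λ ())

parity : ∀ μ δ → (2 * μ + δ) % 2 ≡ δ % 2
parity μ δ = trans (cong (_% 2) (trans (+-comm (2 * μ) δ) (cong (_+_ δ) (*-comm 2 μ))))
  ([m+kn]%n≡m%n δ μ 2)

1≡2μ+δ⇒1≤δ : ∀ {μ δ} → 1 ≡ 2 * μ + δ → 1 ≤ δ
1≡2μ+δ⇒1≤δ {μ} {zero}  1≡2μ = contradiction (trans (cong (_% 2) 1≡2μ) (parity μ 0)) (λ ())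
1≡2μ+δ⇒1≤δ {δ = suc δ} _    = s≤s z≤n

odd-pred⇒δ≥2 : ∀ {n μ δ} → n % 2 ≡ 1 → n ∸ 1 ≡ 2 * μ + δ → 1 ≤ δ → 2 ≤ δ
odd-pred⇒δ≥2 {suc n} {μ} odd n≡2μ+δ 1≤δ with m≤n⇒m<n∨m≡n 1≤δ
... | inj₁ 1<δ = 1<δ
... | inj₂ refl = contradiction (begin
  0                    ≡⟨ parity (suc μ) 0 ⟨
  (2 * suc μ + 0) % 2  ≡⟨ cong (_% 2) (trans (twice-suc μ) (cong suc (sym n≡2μ+δ))) ⟩
  suc n % 2            ≡⟨ odd ⟩
  1                    ∎) (λ ())
  where
  open ≡-Reasoning
  twice-suc : ∀ μ → 2 * suc μ + 0 ≡ suc (2 * μ + 1)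
  twice-suc = solve-∀

-- The rank constraints

module SpanningTreeBounds {n m : ℕ} (G : Graph n m) (r : Fin n) (n-odd : n % 2 ≡ 1)
  (regular : FourRegular G) (connected : FourEdgeConnected G) (no-proper-min-cut : NoProperMinCuts G)
  (side : Fin m → Bool) (M : HE G → Bool) (perfect : PerfectMatchingHat G r side M) where

  open Scaled G M

  N : Fin m → Bool
  N e = M (inj₁ e)

  I : Subset n
  I = ∁ ⁅ r ⁆

  ∈I : ∀ {v} → v ≢ r → v ∈ I
  ∈I v≢r = x∉p⇒x∈∁p (x≢y⇒x∉⁅y⁆ v≢r)

  r∉I : lookup I r ≡ false
  r∉I = ¬-not (λ r∈I → x∈∁p⇒x∉p (lookup⇒[]= r I r∈I) (x∈⁅x⁆ r))

  lookup-I : ∀ v → lookup I v ≡ not (eqF v r)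
  lookup-I v with v ≟ r
  ... | yes refl = r∉I
  ... | no v≢r   = []=⇒lookup (∈I v≢r)

  ∣I∣ : ∣ I ∣ ≡ n ∸ 1
  ∣I∣ = trans (∣∁p∣≡n∸∣p∣ ⁅ r ⁆) (cong (n ∸_) (∣⁅x⁆∣≡1 r))

  inside-I : ∀ g → inside G I g ≡ internal G r g
  inside-I g = trans (cong₂ _∧_ (lookup-I (proj₁ (G g))) (lookup-I (proj₂ (G g))))
    (not-∨ (eqF (proj₁ (G g)) r) (eqF (proj₂ (G g)) r))

  crosses-I : ∀ e → crosses G I e ≡ (eqF (proj₁ (G e)) r xor eqF (proj₂ (G e)) r)
  crosses-I e = trans (cong₂ _xor_ (lookup-I (proj₁ (G e))) (lookup-I (proj₂ (G e))))
    (xor-annihilates-not (eqF (proj₁ (G e)) r) _)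

  module OnSubset (S : Subset n) (r∉S : lookup S r ≡ false) (S≢∅ : 0 < ∣ S ∣) where

    ∈S⇒≢r : ∀ {v} → lookup S v ≡ true → v ≢ r
    ∈S⇒≢r v∈S refl = contradiction (trans (sym v∈S) r∉S) (λ ())

    ⊆I : S ⊆ I
    ⊆I v∈S = ∈I (∈S⇒≢r ([]=⇒lookup v∈S))

    size-bound : ∣ S ∣ ≤ n ∸ 1
    size-bound = subst (∣ S ∣ ≤_) ∣I∣ (p⊆q⇒∣p∣≤∣q∣ ⊆I)

    size-bound-strict : ∀ {w} → lookup S w ≡ false → w ≢ r → ∣ S ∣ < n ∸ 1
    size-bound-strict w∉S w≢r = subst (∣ S ∣ <_) ∣I∣
      (p⊂q⇒∣p∣<∣q∣ (⊆I , _ , ∈I w≢r , λ w∈S → contradiction (trans (sym ([]=⇒lookup w∈S)) w∉S) (λ ())))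

    internal-outside : ∀ {f} → internal G r f ≡ true → inside G S f ≡ false → ∣ S ∣ < n ∸ 1
    internal-outside {f} f-int f∉S with nor-true {eqF (proj₁ (G f)) r} f-int
    ... | p₁≢r , p₂≢r with ∧-false {lookup S (proj₁ (G f))} f∉S
    ...   | inj₁ p₁∉S = size-bound-strict p₁∉S (eqF⇒≢ p₁≢r)
    ...   | inj₂ p₂∉S = size-bound-strict p₂∉S (eqF⇒≢ p₂≢r)

    -- One end of e is r ∉ S, the end it shares with f lies in S.
    incident-crosses : ∀ {e f} → incident G r e ≡ true → inside G S f ≡ true → shareEnd G e f ≡ true →
      crosses G S e ≡ true
    incident-crosses {e} {f} e-at-r f∈S shared = xor-true shared-end r-end
      where
      via : ∀ {x y} → eqF x y ≡ true → lookup S y ≡ true → lookup S x ≡ true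
      via x≡y y∈S = trans (cong (lookup S) (eqF⇒≡ x≡y)) y∈S
      ends-f : lookup S (proj₁ (G f)) ≡ true × lookup S (proj₂ (G f)) ≡ true
      ends-f = ∧-true f∈S
      shared-end : lookup S (proj₁ (G e)) ≡ true ⊎ lookup S (proj₂ (G e)) ≡ true
      shared-end with ∨-true {eqF (proj₁ (G e)) (proj₁ (G f))} shared
      ... | inj₁ q = inj₁ (via q (proj₁ ends-f))
      ... | inj₂ s with ∨-true {eqF (proj₁ (G e)) (proj₂ (G f))} s
      ...   | inj₁ q = inj₁ (via q (proj₂ ends-f))
      ...   | inj₂ s′ with ∨-true {eqF (proj₂ (G e)) (proj₁ (G f))} s′
      ...     | inj₁ q = inj₂ (via q (proj₁ ends-f))
      ...     | inj₂ q = inj₂ (via q (proj₂ ends-f))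
      r-end : lookup S (proj₁ (G e)) ≡ false ⊎ lookup S (proj₂ (G e)) ≡ false
      r-end with ∨-true {eqF (proj₁ (G e)) r} e-at-r
      ... | inj₁ q = inj₁ (trans (cong (lookup S) (eqF⇒≡ q)) r∉S)
      ... | inj₂ q = inj₂ (trans (cong (lookup S) (eqF⇒≡ q)) r∉S)

    k c μ δ : ℕ
    k = ∣ S ∣
    c = cut G S
    μ = count (λ e → N e ∧ inside G S e)
    δ = count (λ e → N e ∧ crosses G S e)

    handshake : 4 * k ≡ 2 * count (inside G S) + c
    handshake = regular-handshake G regular S

    matching : k ≡ 2 * μ + δ
    matching = perfect-on-subset G N S covered
      where
      covered : ∀ v → lookup S v ≡ true → degreeIn G N v ≡ 1
      covered v v∈S = trans (sym (coveredHat-away G r side M (∈S⇒≢r v∈S))) (perfect (inj₁ v))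

    y₃-identity : 2 * sumOn (inside G S) y₃ + (c + 2 * δ) ≡ 6 * k
    y₃-identity = trans (cong (λ B → 2 * B + (c + 2 * δ)) (sumOn-y₃ (inside G S)))
      (scaled-identity {k} {count (inside G S)} {c} {μ} {δ} handshake matching)

    c≥4 : 4 ≤ c
    c≥4 = connected S S≢∅ (positive-≤-pred⇒< S≢∅ size-bound)

    non-maximal⇒6≤c+2δ : k < n ∸ 1 → 6 ≤ c + 2 * δ
    non-maximal⇒6≤c+2δ k<n-1 with m≤n⇒m<n∨m≡n S≢∅
    ... | inj₁ 1<k = ≤-trans (no-proper-min-cut S 1<k k<n-1) (m≤m+n c (2 * δ))
    ... | inj₂ 1≡k = +-mono-≤ c≥4 (*-monoʳ-≤ 2 (1≡2μ+δ⇒1≤δ {μ} {δ} (trans 1≡k matching)))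

    maximal⇒2≤δ : k ≡ n ∸ 1 → 1 ≤ δ → 2 ≤ δ
    maximal⇒2≤δ k≡n-1 = odd-pred⇒δ≥2 {n} {μ} {δ} n-odd (trans (sym k≡n-1) matching)

    -- A loop at the only vertex of S would leave degree at most 2 for the cut.
    inside-edge⇒1<k : ∀ {f} → inside G S f ≡ true → 1 < k
    inside-edge⇒1<k {f} f∈S with m≤n⇒m<n∨m≡n S≢∅
    ... | inj₁ 1<k = 1<k
    ... | inj₂ 1≡k = contradiction (begin
      6                            ≤⟨ +-mono-≤ (*-monoʳ-≤ 2 edge) c≥4 ⟩
      2 * count (inside G S) + c   ≡⟨ handshake ⟨
      4 * k                        ≡⟨ cong (4 *_) 1≡k ⟨
      4                            ∎) (λ { (s≤s (s≤s (s≤s (s≤s ())))) })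
      where
      open ≤-Reasoning
      edge : 1 ≤ count (inside G S)
      edge = ≤-trans (≤-reflexive (cong b2n (sym f∈S))) (term≤sumℕ (λ g → b2n (inside G S g)) f)

    matched-crossing : ∀ {e f} → incident G r e ≡ true → N e ≡ true → inside G S f ≡ true →
      shareEnd G e f ≡ true → 1 ≤ δ
    matched-crossing {e} e-at-r e∈M f∈S shared = ≤-trans
      (≤-reflexive (cong₂ (λ a b → b2n (a ∧ b)) (sym e∈M) (sym (incident-crosses e-at-r f∈S shared))))
      (term≤sumℕ (λ g → b2n (N g ∧ crosses G S g)) e)

    decrease-equation : ∀ f → 2 * sumOn (inside G S) (ŷ₃⁻ f) + (2 * b2n (inside G S f) + (c + 2 * δ)) ≡ 6 * k + 0
    decrease-equation f = begin
      2 * Σŷ + (2 * F + X)           ≡⟨ regroup Σŷ F X ⟩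
      2 * (Σŷ + F) + X               ≡⟨ cong (λ B → 2 * B + X) (sumOn-ŷ₃⁻ f (inside G S)) ⟩
      2 * sumOn (inside G S) y₃ + X  ≡⟨ y₃-identity ⟩
      6 * k                          ≡⟨ +-identityʳ (6 * k) ⟨
      6 * k + 0                      ∎
      where
      open ≡-Reasoning
      Σŷ F X : ℕ
      Σŷ = sumOn (inside G S) (ŷ₃⁻ f)
      F = b2n (inside G S f)
      X = c + 2 * δ
      regroup : ∀ T F X → 2 * T + (2 * F + X) ≡ 2 * (T + F) + X
      regroup = solve-∀

    increase-equation : ∀ f → 2 * sumOn (inside G S) (ŷ₃⁺ f) + (c + 2 * δ) ≡ 6 * k + 2 * b2n (inside G S f)
    increase-equation f = begin
      2 * sumOn (inside G S) (ŷ₃⁺ f) + X  ≡⟨ cong (λ T → 2 * T + X) (sumOn-ŷ₃⁺ f (inside G S)) ⟩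
      2 * (B + F) + X                     ≡⟨ regroup B F X ⟩
      (2 * B + X) + 2 * F                 ≡⟨ cong (_+ 2 * F) y₃-identity ⟩
      6 * k + 2 * F                       ∎
      where
      open ≡-Reasoning
      B F X : ℕ
      B = sumOn (inside G S) y₃
      F = b2n (inside G S f)
      X = c + 2 * δ
      regroup : ∀ B F X → 2 * (B + F) + X ≡ (2 * B + X) + 2 * F
      regroup = solve-∀

    decrease-bound : ∀ f → internal G r f ≡ true → sumOn (inside G S) (ŷ₃⁻ f) ≤ 3 * (k ∸ 1)
    decrease-bound f f-int = scaled-bound {k = k} (decrease-equation f) slack
      where
      slack : 6 + 0 ≤ 2 * b2n (inside G S f) + (c + 2 * δ)
      slack with inside G S f in f∈S
      ... | false = non-maximal⇒6≤c+2δ (internal-outside f-int f∈S)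
      ... | true  = +-monoʳ-≤ 2 (≤-trans c≥4 (m≤m+n c (2 * δ)))

    increase-bound : ∀ {e f} → incident G r e ≡ true → N e ≡ true → internal G r f ≡ true →
      shareEnd G e f ≡ true → sumOn (inside G S) (ŷ₃⁺ f) ≤ 3 * (k ∸ 1)
    increase-bound {f = f} e-at-r e∈M f-int shared = scaled-bound {k = k} (increase-equation f) slack
      where
      slack : 6 + 2 * b2n (inside G S f) ≤ c + 2 * δ
      slack with inside G S f in f∈S
      ... | false = non-maximal⇒6≤c+2δ (internal-outside f-int f∈S)
      ... | true with m≤n⇒m<n∨m≡n size-bound
      ...   | inj₁ k<n-1 = +-mono-≤ (no-proper-min-cut S (inside-edge⇒1<k f∈S) k<n-1)
                                   (*-monoʳ-≤ 2 (matched-crossing e-at-r e∈M f∈S shared))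
      ...   | inj₂ k≡n-1 = +-mono-≤ c≥4
                                   (*-monoʳ-≤ 2 (maximal⇒2≤δ k≡n-1 (matched-crossing e-at-r e∈M f∈S shared)))

  module OnI (n≥4 : 4 ≤ n) where

    I≢∅ : 0 < ∣ I ∣
    I≢∅ = subst (0 <_) (sym ∣I∣) (≤-trans (s≤s z≤n) (∸-monoˡ-≤ 1 n≥4))

    open OnSubset I r∉I I≢∅

    cut-I : c ≡ 4
    cut-I = ≤-antisym (≤-trans (sumℕ-mono crossing≤ends) (≤-reflexive (regular r))) c≥4
      where
      crossing≤ends : ∀ e → b2n (crosses G I e) ≤ ends G e r
      crossing≤ends e = subst (λ b → b2n b ≤ ends G e r) (sym (crosses-I e))
        (b2n-xor≤ (eqF (proj₁ (G e)) r) (eqF (proj₂ (G e)) r))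

    δ≤matched-at-r : δ ≤ count (λ e → incident G r e ∧ N e)
    δ≤matched-at-r = sumℕ-mono λ e →
      subst (λ b → b2n (N e ∧ b) ≤ b2n (incident G r e ∧ N e)) (sym (crosses-I e))
        (b2n-∧-xor≤ (N e) (eqF (proj₁ (G e)) r) (eqF (proj₂ (G e)) r))

    sumOn-internal : ∀ t → sumOn (internal G r) t ≡ sumOn (inside G I) t
    sumOn-internal t = sumℕ-cong (λ g → cong (λ b → if b then t g else 0) (sym (inside-I g)))

    rank-I : 3 * (k ∸ 1) ≡ 3 * (n ∸ 2)
    rank-I = cong (λ x → 3 * x) (trans (cong (_∸ 1) ∣I∣) (∸-+-assoc n 1 1))

    decrease-total : count (λ e → incident G r e ∧ N e) ≡ 0 → ∀ {f} → internal G r f ≡ true →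
      sumOn (internal G r) (ŷ₃⁻ f) ≡ 3 * (n ∸ 2)
    decrease-total none {f} f-int =
      trans (sumOn-internal (ŷ₃⁻ f)) (trans (scaled-exact {k = k} (decrease-equation f) six) rank-I)
      where
      δ≡0 : δ ≡ 0
      δ≡0 = n≤0⇒n≡0 (≤-trans δ≤matched-at-r (≤-reflexive none))
      six : 2 * b2n (inside G I f) + (c + 2 * δ) ≡ 6 + 0
      six rewrite inside-I f | f-int | cut-I | δ≡0 = refl

    increase-total : count (λ e → incident G r e ∧ N e) ≡ 2 → ∀ {e f} → incident G r e ≡ true → N e ≡ true →
      internal G r f ≡ true → shareEnd G e f ≡ true → sumOn (internal G r) (ŷ₃⁺ f) ≡ 3 * (n ∸ 2)
    increase-total two {f = f} e-at-r e∈M f-int shared =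
      trans (sumOn-internal (ŷ₃⁺ f)) (trans (scaled-exact {k = k} (increase-equation f) eight) rank-I)
      where
      f∈I : inside G I f ≡ true
      f∈I = trans (inside-I f) f-int
      δ≡2 : δ ≡ 2
      δ≡2 = ≤-antisym (≤-trans δ≤matched-at-r (≤-reflexive two))
        (maximal⇒2≤δ ∣I∣ (matched-crossing e-at-r e∈M f∈I shared))
      eight : c + 2 * δ ≡ 6 + 2 * b2n (inside G I f)
      eight rewrite f∈I | cut-I | δ≡2 = refl

claimB3 : (n m : ℕ) (G : Graph n m) (r : Fin n) →
    4 ≤ n → n % 2 ≡ 1 →
    FourRegular G → FourEdgeConnected G → NoProperMinCuts G →
    (side : Fin m → Bool) → ValidSplit G r side →
    (D : Dist G) → IsQuarterMatchingDist G r side D →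
    (M : HE G → Bool) → InSupport G D M →
    (count (λ e → incident G r e ∧ M (inj₁ e)) ≡ 0 →
      ∀ (e f : Fin m) → incident G r e ≡ true → internal G r f ≡ true → shareEnd G e f ≡ true →
      InSpanningTreePolytope G r (modify G (yVec G M) f (- (+ 1 / 3))))
    ×
    (count (λ e → incident G r e ∧ M (inj₁ e)) ≡ 2 →
      ∀ (e f : Fin m) → incident G r e ≡ true → M (inj₁ e) ≡ true → internal G r f ≡ true → shareEnd G e f ≡ true →
      InSpanningTreePolytope G r (modify G (yVec G M) f (+ 1 / 3)))
claimB3 _ _ G r n≥4 n-odd regular connected no-proper-min-cut side _ _ (all-perfect , _ , _) M (_ , M∈D , _) =
  (λ none _ f _ f-int _ →
    in-polytope G r (ŷ₃⁻ f) (modify-decrease f) (decrease-total none f-int)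
      (λ S r∉S S≢∅ → OnSubset.decrease-bound S r∉S S≢∅ f f-int)) ,
  (λ two e f e-at-r e∈M f-int shared →
    in-polytope G r (ŷ₃⁺ f) (modify-increase f) (increase-total two e-at-r e∈M f-int shared)
      (λ S r∉S S≢∅ → OnSubset.increase-bound S r∉S S≢∅ e-at-r e∈M f-int shared))
  where
  open Scaled G M
  open SpanningTreeBounds G r n-odd regular connected no-proper-min-cut side M
    (proj₁ (All.lookup all-perfect M∈D))
  open OnI n≥4
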